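{- Let $m\ge 3$ and $n\ge 2$, let $G$ be either $C_n\times K_m$ or $P_n\times K_m$, and let $S$ be a secure dominating set of $G$. For $i\in[n]$ let $s_i=|S\cap X_i|$, where $X_i=\{(i,j):j\in[m]\}$, with the conventions $s_0=s_{n+1}=0$ when $G=P_n\times K_m$, and $s_0=s_n$, $s_{n+1}=s_1$ when $G=C_n\times K_m$. Then $s_{i-1}+s_i+s_{i+1}\ge 3$ for every $1\le i\le n$.
   Context: $[n]=\{1,\dots,n\}$. $P_n$ is the path on $[n]$ with edges $\{i,i+1\}$; $C_n$ is the cycle on $[n]$ with edges $\{i,i+1\}$ and $\{n,1\}$ ($C_2$ is understood as the single edge $\{1,2\}$); $K_m$ is the complete graph on $[m]$. The direct product $G\times H$ has vertex set $V(G)\times V(H)$ with $(g_1,h_1)\sim(g_2,h_2)$ iff $g_1g_2\in E(G)$ and $h_1h_2\in E(H)$. A set $D$ is dominating if every vertex not in $D$ is adjacent to a vertex of $D$. A set $S$ is a secure dominating set if it is dominating and for every vertex $w\notin S$ there is a neighbor $v\in S$ of $w$ such that $(S\setminus\{v\})\cup\{w\}$ is dominating. -}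

module Defs where

open import Data.Nat using (ℕ; zero; suc; _+_; _∸_; _<?_)
open import Data.Fin using (Fin; toℕ; fromℕ<)
open import Data.Fin.Properties using () renaming (_≟_ to _≟ᶠ_)
open import Data.Bool using (Bool; true; false; if_then_else_)
open import Data.Product using (_×_; _,_; Σ; ∃)
open import Data.Sum using (_⊎_)
open import Relation.Binary.PropositionalEquality using (_≡_)
open import Relation.Nullary using (¬_; yes; no; does)
open import Relation.Nullary.Decidable using (⌊_⌋)
open import Data.Product.Properties using (≡-dec)
open import Data.List using (List; map)
open import Data.Nat.ListAction using (sum)
open import Data.List using () renaming (allFin to allFinL)
open import Data.Nat.Properties using (n<1+n)

Dominating : {V : Set} → (V → V → Set) → (V → Bool) → Set
Dominating {V} Adj S = ∀ (w : V) → S w ≡ false → Σ V λ v → S v ≡ true × Adj v w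

swap : {V : Set} → ((x y : V) → Relation.Nullary.Dec (x ≡ y)) →
       (V → Bool) → V → V → (V → Bool)
swap _≟_ S v w u = if does (u ≟ w) then true else (if does (u ≟ v) then false else S u)

SecureDominating : {V : Set} → ((x y : V) → Relation.Nullary.Dec (x ≡ y)) →
                   (V → V → Set) → (V → Bool) → Set
SecureDominating _≟_ Adj S =
  Dominating Adj S ×
  (∀ w → S w ≡ false →
     Σ _ λ v → S v ≡ true × Adj v w × Dominating Adj (swap _≟_ S v w))

-- Factor graphs.  Vertex i : Fin n stands for the vertex toℕ i + 1 ∈ [n].

data Kind : Set where
  cycleK pathK : Kind

PathAdj : (n : ℕ) → Fin n → Fin n → Set
PathAdj n i j = (suc (toℕ i) ≡ toℕ j) ⊎ (suc (toℕ j) ≡ toℕ i)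

-- C_n: edges {i, i+1} and {n, 1} (for n = 2 this is the same single edge)
CycleAdj : (n : ℕ) → Fin n → Fin n → Set
CycleAdj n i j = PathAdj n i j ⊎
                 ((toℕ i ≡ 0 × toℕ j ≡ n ∸ 1) ⊎ (toℕ j ≡ 0 × toℕ i ≡ n ∸ 1))

FactorAdj : Kind → (n : ℕ) → Fin n → Fin n → Set
FactorAdj cycleK = CycleAdj
FactorAdj pathK  = PathAdj

CompleteAdj : (m : ℕ) → Fin m → Fin m → Set
CompleteAdj m a b = ¬ (a ≡ b)

ProdAdj : Kind → (n m : ℕ) → (Fin n × Fin m) → (Fin n × Fin m) → Set
ProdAdj k n m (g₁ , h₁) (g₂ , h₂) = FactorAdj k n g₁ g₂ × CompleteAdj m h₁ h₂

vertexDec : (n m : ℕ) → (x y : Fin n × Fin m) → Relation.Nullary.Dec (x ≡ y)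
vertexDec n m = ≡-dec _≟ᶠ_ _≟ᶠ_

rowCount : (n m : ℕ) → (Fin n × Fin m → Bool) → Fin n → ℕ
rowCount n m S i = sum (map (λ j → if S (i , j) then 1 else 0) (allFinL m))

-- s_k for k ∈ {0, …, n+1} (1-indexed, with the paper's boundary conventions):
-- path: s_0 = s_{n+1} = 0;  cycle: s_0 = s_n, s_{n+1} = s_1.
sExt : Kind → (n m : ℕ) → (Fin n × Fin m → Bool) → ℕ → ℕ
sExt k n m S zero with n | k
... | zero  | _      = 0
... | suc p | cycleK = rowCount (suc p) m S (fromℕ< {p} (n<1+n p))
... | suc p | pathK  = 0
sExt k n m S (suc t) with t <? n
... | yes t<n = rowCount n m S (fromℕ< t<n)
... | no _ with k | 0 <? n
...   | cycleK | yes 0<n = rowCount n m S (fromℕ< 0<n)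
...   | _      | _       = 0

{-# OPTIONS --safe #-}
module Submission where

-- Call a vertex of S nearby if its row is i or adjacent to i. Listing the rows at the
-- positions i - 1, i, i + 1 (boundary conventions included) covers every nearby vertex, and
-- counting S along that list gives s_{i-1} + s_i + s_{i+1}; so three distinct nearby vertices
-- suffice. They come from secure domination: given nearby x and y, choose a column d missing
-- both (m ≥ 3). Either (i , d) ∈ S, or its defender v is new, or v ∈ {x , y}; in the last case
-- some (i , e) outside S ∖ {v} ∪ {(i , d)} must be dominated there by a vertex of S other
-- than v, since a row is independent in C_n × K_m and P_n × K_m (n ≥ 2), and e is chosen so
-- that this vertex is new.

open import Defs
open import Data.Bool using (Bool; true; false; if_then_else_)
open import Data.Empty using (⊥-elim)
open import Data.Fin using (Fin; zero; suc; toℕ; fromℕ<)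
open import Data.Fin.Properties using (toℕ-injective; toℕ-fromℕ<; fromℕ<-toℕ; toℕ<n)
open import Data.List using (List; []; _∷_; _++_; map; length; allFin)
open import Data.List.Properties using (map-++; map-∘)
open import Data.List.Membership.Propositional using (_∈_)
open import Data.List.Membership.Propositional.Properties
  using (∈-map⁺; ∈-allFin; ∈-++⁺ˡ; ∈-++⁺ʳ)
open import Data.List.Relation.Unary.All as All using (All; []; _∷_)
open import Data.List.Relation.Unary.AllPairs using ([]; _∷_)
open import Data.List.Relation.Unary.Any using (here; there)
open import Data.List.Relation.Unary.Unique.Propositional using (Unique)
open import Data.Maybe using (Maybe; just; nothing; maybe)
open import Data.Nat using (ℕ; zero; suc; _+_; _∸_; _≤_; _<_; z≤n; s≤s; _<?_)
open import Data.Nat.ListAction using (sum)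
open import Data.Nat.ListAction.Properties using (sum-++)
open import Data.Nat.Properties
  using (≤-trans; m≤n+m; +-monoʳ-≤; +-monoʳ-<; +-assoc; +-comm; n<1+n; <-irrefl; 1+n≢n)
open import Data.Product using (Σ; ∃; _×_; _,_; proj₁; proj₂)
open import Data.Product.Properties using (,-injectiveʳ)
open import Data.Sum using (_⊎_; inj₁; inj₂)
open import Function using (_∘′_)
open import Relation.Binary.Definitions using (DecidableEquality)
open import Relation.Binary.PropositionalEquality
  using (_≡_; _≢_; refl; sym; trans; cong; subst)
open import Relation.Nullary using (¬_; yes; no; does)

countTrue : {A : Set} → (A → Bool) → List A → ℕ
countTrue f xs = sum (map (λ x → if f x then 1 else 0) xs)

countTrue-++ : {A : Set} (f : A → Bool) (xs ys : List A) →
               countTrue f (xs ++ ys) ≡ countTrue f xs + countTrue f ys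
countTrue-++ f xs ys = trans (cong sum (map-++ _ xs ys)) (sum-++ (map _ xs) (map _ ys))

module _ {A : Set} (_≟_ : DecidableEquality A) where

  delete : A → (A → Bool) → A → Bool
  delete a f x = if does (x ≟ a) then false else f x

  delete-≢ : ∀ {a x} (f : A → Bool) → x ≢ a → delete a f x ≡ f x
  delete-≢ {a} {x} f x≢a with x ≟ a
  ... | yes x≡a = ⊥-elim (x≢a x≡a)
  ... | no _    = refl

  countTrue-delete-≤ : ∀ a f xs → countTrue (delete a f) xs ≤ countTrue f xs
  countTrue-delete-≤ a f []       = z≤n
  countTrue-delete-≤ a f (x ∷ xs) with x ≟ a
  ... | yes _ = ≤-trans (countTrue-delete-≤ a f xs) (m≤n+m _ _)
  ... | no _  = +-monoʳ-≤ _ (countTrue-delete-≤ a f xs)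

  countTrue-delete-< : ∀ {a f xs} → a ∈ xs → f a ≡ true →
                       countTrue (delete a f) xs < countTrue f xs
  countTrue-delete-< {a} {f} {_ ∷ xs} (here refl) fa with a ≟ a
  ... | yes _   rewrite fa = s≤s (countTrue-delete-≤ a f xs)
  ... | no a≢a  = ⊥-elim (a≢a refl)
  countTrue-delete-< {a} {f} {x ∷ xs} (there a∈xs) fa with x ≟ a
  ... | yes _ = ≤-trans (countTrue-delete-< a∈xs fa) (m≤n+m _ _)
  ... | no _  = +-monoʳ-< _ (countTrue-delete-< a∈xs fa)

  length-≤-countTrue : ∀ {f xs ys} → Unique ys → All (_∈ xs) ys →
                       All (λ y → f y ≡ true) ys → length ys ≤ countTrue f xs
  length-≤-countTrue []                  []               []          = z≤n
  length-≤-countTrue {f} (y≢ys ∷ unique) (y∈xs ∷ ys⊆xs) (fy ∷ fys) =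
    ≤-trans (s≤s (length-≤-countTrue unique ys⊆xs (All.zipWith still-true (y≢ys , fys))))
            (countTrue-delete-< y∈xs fy)
    where
    still-true : ∀ {z} → _ ≢ z × f z ≡ true → delete _ f z ≡ true
    still-true (y≢z , fz) = trans (delete-≢ f (y≢z ∘′ sym)) fz

module _ {V : Set} (_≟_ : DecidableEquality V) (Adj : V → V → Set) (S : V → Bool) where

  swap-≢ : ∀ {v w u} → u ≢ w → u ≢ v → swap _≟_ S v w u ≡ S u
  swap-≢ {v} {w} {u} u≢w u≢v with u ≟ w | u ≟ v
  ... | yes u≡w | _       = ⊥-elim (u≢w u≡w)
  ... | no _    | yes u≡v = ⊥-elim (u≢v u≡v)
  ... | no _    | no _    = refl

  swap-removed : ∀ {v w} → v ≢ w → swap _≟_ S v w v ≡ false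
  swap-removed {v} {w} v≢w with v ≟ w | v ≟ v
  ... | yes v≡w | _       = ⊥-elim (v≢w v≡w)
  ... | no _    | yes _   = refl
  ... | no _    | no v≢v  = ⊥-elim (v≢v refl)

  dominator-after-swap : ∀ {v w u} → Dominating Adj (swap _≟_ S v w) →
                         S v ≡ true → S u ≡ false → u ≢ w → ¬ Adj w u →
                         Σ V λ y → S y ≡ true × Adj y u × y ≢ v
  dominator-after-swap {v} {w} {u} dom Sv Su u≢w ¬w~u = kept (dom u (trans (swap-≢ u≢w u≢v) Su))
    where
    u≢v : u ≢ v
    u≢v u≡v with trans (sym Su) (trans (cong S u≡v) Sv)
    ... | ()

    kept : Σ V (λ y → swap _≟_ S v w y ≡ true × Adj y u) →
           Σ V λ y → S y ≡ true × Adj y u × y ≢ v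
    kept (y , S′y , y~u) = y , trans (sym (swap-≢ y≢w y≢v)) S′y , y~u , y≢v
      where
      y≢w : y ≢ w
      y≢w refl = ¬w~u y~u

      y≢v : y ≢ v
      y≢v refl with trans (sym S′y) (swap-removed y≢w)
      ... | ()

PathAdj-irrefl : ∀ {n} (i : Fin n) → ¬ PathAdj n i i
PathAdj-irrefl i (inj₁ e) = 1+n≢n e
PathAdj-irrefl i (inj₂ e) = 1+n≢n e

FactorAdj-irrefl : ∀ k {n} (i : Fin (2 + n)) → ¬ FactorAdj k (2 + n) i i
FactorAdj-irrefl pathK  i adj                  = PathAdj-irrefl i adj
FactorAdj-irrefl cycleK i (inj₁ adj)           = PathAdj-irrefl i adj
FactorAdj-irrefl cycleK i (inj₂ (inj₁ (i≡0 , i≡last))) with trans (sym i≡0) i≡last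
... | ()
FactorAdj-irrefl cycleK i (inj₂ (inj₂ (i≡0 , i≡last))) with trans (sym i≡0) i≡last
... | ()

avoid-two : ∀ {m} (a b : Fin (3 + m)) → ∃ λ d → d ≢ a × d ≢ b
avoid-two zero          zero          = suc zero , (λ ()) , (λ ())
avoid-two zero          (suc zero)    = suc (suc zero) , (λ ()) , (λ ())
avoid-two zero          (suc (suc _)) = suc zero , (λ ()) , (λ ())
avoid-two (suc zero)    zero          = suc (suc zero) , (λ ()) , (λ ())
avoid-two (suc (suc _)) zero          = suc zero , (λ ()) , (λ ())
avoid-two (suc _)       (suc _)       = zero , (λ ()) , (λ ())

-- Positions are the paper's 1-based row indices: row r sits at position toℕ r + 1.
rowAt : Kind → (n : ℕ) → ℕ → Maybe (Fin n)
rowAt k n (suc t) with t <? n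
... | yes t<n = just (fromℕ< t<n)
rowAt pathK  _       (suc t) | no _ = nothing
rowAt cycleK zero    (suc t) | no _ = nothing
rowAt cycleK (suc n) (suc t) | no _ = just zero
rowAt pathK  _       zero = nothing
rowAt cycleK zero    zero = nothing
rowAt cycleK (suc n) zero = just (fromℕ< (n<1+n n))

sExt-rowAt : ∀ k n m S p → sExt k n m S p ≡ maybe (rowCount n m S) 0 (rowAt k n p)
sExt-rowAt k n m S (suc t) with t <? n
... | yes _ = refl
sExt-rowAt pathK  n       m S (suc t) | no _ = refl
sExt-rowAt cycleK zero    m S (suc t) | no _ = refl
sExt-rowAt cycleK (suc n) m S (suc t) | no _ = refl
sExt-rowAt pathK  zero    m S zero = refl
sExt-rowAt pathK  (suc n) m S zero = refl
sExt-rowAt cycleK zero    m S zero = refl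
sExt-rowAt cycleK (suc n) m S zero = refl

rowVertices : ∀ {n} m → Fin n → List (Fin n × Fin m)
rowVertices m r = map (r ,_) (allFin m)

verticesAt : Kind → (n m : ℕ) → ℕ → List (Fin n × Fin m)
verticesAt k n m p = maybe (rowVertices m) [] (rowAt k n p)

-- For C₂ the other row occurs twice, just as it is counted twice by s_{i-1} + s_{i+1}.
window : Kind → (n m : ℕ) → ℕ → List (Fin n × Fin m)
window k n m p = verticesAt k n m p ++ verticesAt k n m (suc p) ++ verticesAt k n m (suc (suc p))

countTrue-verticesAt : ∀ k n m S p → countTrue S (verticesAt k n m p) ≡ sExt k n m S p
countTrue-verticesAt k n m S p rewrite sExt-rowAt k n m S p with rowAt k n p
... | just r  = cong sum (sym (map-∘ (allFin m)))
... | nothing = refl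

countTrue-window : ∀ k n m S p →
  countTrue S (window k n m p) ≡ sExt k n m S p + sExt k n m S (suc p) + sExt k n m S (suc (suc p))
countTrue-window k n m S p
  rewrite countTrue-++ S (verticesAt k n m p) (verticesAt k n m (suc p) ++ verticesAt k n m (suc (suc p)))
        | countTrue-++ S (verticesAt k n m (suc p)) (verticesAt k n m (suc (suc p)))
        | countTrue-verticesAt k n m S p
        | countTrue-verticesAt k n m S (suc p)
        | countTrue-verticesAt k n m S (suc (suc p))
  = sym (+-assoc (sExt k n m S p) (sExt k n m S (suc p)) (sExt k n m S (suc (suc p))))

∈-verticesAt : ∀ {k n m r} p (c : Fin m) → rowAt k n p ≡ just r → (r , c) ∈ verticesAt k n m p
∈-verticesAt p c r-at-p rewrite r-at-p = ∈-map⁺ (_ ,_) (∈-allFin c)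

rowAt-suc-toℕ : ∀ k {n} (r : Fin n) → rowAt k n (suc (toℕ r)) ≡ just r
rowAt-suc-toℕ k {n} r with toℕ r <? n
... | yes r<n = cong just (fromℕ<-toℕ r r<n)
... | no r≮n  = ⊥-elim (r≮n (toℕ<n r))

rowAt-past-end : ∀ n → rowAt cycleK (suc n) (suc (suc n)) ≡ just zero
rowAt-past-end n with suc n <? suc n
... | yes n<n = ⊥-elim (<-irrefl refl n<n)
... | no _    = refl

PathAdj-position : ∀ k {n} {r i : Fin n} → PathAdj n r i →
  rowAt k n (toℕ i) ≡ just r ⊎ rowAt k n (suc (suc (toℕ i))) ≡ just r
PathAdj-position k {r = r} (inj₁ 1+r≡i) =
  inj₁ (subst (λ p → rowAt k _ p ≡ just r) 1+r≡i (rowAt-suc-toℕ k r))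
PathAdj-position k {r = r} (inj₂ 1+i≡r) =
  inj₂ (subst (λ p → rowAt k _ (suc p) ≡ just r) (sym 1+i≡r) (rowAt-suc-toℕ k r))

FactorAdj-position : ∀ k {n} {r i : Fin (suc n)} → FactorAdj k (suc n) r i →
  rowAt k (suc n) (toℕ i) ≡ just r ⊎ rowAt k (suc n) (suc (suc (toℕ i))) ≡ just r
FactorAdj-position pathK  adj        = PathAdj-position pathK adj
FactorAdj-position cycleK (inj₁ adj) = PathAdj-position cycleK adj
FactorAdj-position cycleK {n} {r} {i} (inj₂ (inj₁ (r≡0 , i≡last)))
  rewrite i≡last | toℕ-injective {i = r} {j = zero} r≡0 = inj₂ (rowAt-past-end n)
FactorAdj-position cycleK {n} {r} {i} (inj₂ (inj₂ (i≡0 , r≡last)))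
  rewrite i≡0 = inj₁ (cong just (toℕ-injective (trans (toℕ-fromℕ< (n<1+n n)) (sym r≡last))))

Near : Kind → (n : ℕ) → Fin n → Fin n → Set
Near k n i r = r ≡ i ⊎ FactorAdj k n r i

∈-window : ∀ {k n m} {i r : Fin (suc n)} (c : Fin m) → Near k (suc n) i r →
           (r , c) ∈ window k (suc n) m (toℕ i)
∈-window {k} {n} {m} {i} c (inj₁ refl) =
  ∈-++⁺ʳ (verticesAt k (suc n) m (toℕ i))
    (∈-++⁺ˡ (∈-verticesAt (suc (toℕ i)) c (rowAt-suc-toℕ k i)))
∈-window {k} {n} {m} {i} c (inj₂ adj) with FactorAdj-position k adj
... | inj₁ at-left  = ∈-++⁺ˡ (∈-verticesAt (toℕ i) c at-left)
... | inj₂ at-right = ∈-++⁺ʳ (verticesAt k (suc n) m (toℕ i))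
                        (∈-++⁺ʳ (verticesAt k (suc n) m (suc (toℕ i)))
                          (∈-verticesAt (suc (suc (toℕ i))) c at-right))

module _ (k : Kind) (n′ m′ : ℕ) (S : Fin (2 + n′) × Fin (3 + m′) → Bool)
         (secure : SecureDominating (vertexDec (2 + n′) (3 + m′)) (ProdAdj k (2 + n′) (3 + m′)) S)
         (i : Fin (2 + n′)) where

  private
    n m : ℕ
    n = 2 + n′
    m = 3 + m′

    Vertex : Set
    Vertex = Fin n × Fin m

    Adj : Vertex → Vertex → Set
    Adj = ProdAdj k n m

    Swapped : Vertex → Vertex → Set
    Swapped v w = Dominating Adj (swap (vertexDec n m) S v w)

  Nearby : Vertex → Set
  Nearby (r , c) = S (r , c) ≡ true × Near k n i r

  off-row : ∀ {r} {c e : Fin m} → FactorAdj k n r i → (r , c) ≢ (i , e)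
  off-row r~i refl = FactorAdj-irrefl k i r~i

  row-or-dominator : ∀ {v d} e → e ≢ d → S v ≡ true → Swapped v (i , d) →
                     S (i , e) ≡ true ⊎ Σ Vertex λ z → S z ≡ true × Adj z (i , e) × z ≢ v
  row-or-dominator e e≢d Sv dom with S (i , e) in Sie
  ... | true  = inj₁ refl
  ... | false = inj₂ (dominator-after-swap (vertexDec n m) Adj S dom Sv Sie
                        (e≢d ∘′ ,-injectiveʳ) (λ (i~i , _) → FactorAdj-irrefl k i i~i))

  nearby-avoiding-defender : ∀ {v d} (y : Vertex) →
                             S v ≡ true → Adj v (i , d) → Swapped v (i , d) →
                             Near k n i (proj₁ y) → d ≢ proj₂ y →
                             Σ Vertex λ z → Nearby z × z ≢ v × z ≢ y
  nearby-avoiding-defender {_ , _} {d} (_ , cy) Sv (v~i , _) dom (inj₁ refl) d≢cy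
    with avoid-two d cy
  ... | e , e≢d , e≢cy with row-or-dominator e e≢d Sv dom
  ...   | inj₁ Sie = (i , e) , (Sie , inj₁ refl) , off-row v~i ∘′ sym , e≢cy ∘′ ,-injectiveʳ
  ...   | inj₂ (z , Sz , (z~i , _) , z≢v) = z , (Sz , inj₂ z~i) , z≢v , off-row z~i
  nearby-avoiding-defender {_ , _} (_ , cy) Sv (v~i , _) dom (inj₂ y~i) d≢cy
    with row-or-dominator cy (d≢cy ∘′ sym) Sv dom
  ... | inj₁ Sicy = (i , cy) , (Sicy , inj₁ refl) , off-row v~i ∘′ sym , off-row y~i ∘′ sym
  ... | inj₂ (z , Sz , (z~i , z≢cy) , z≢v) = z , (Sz , inj₂ z~i) , z≢v , z≢cy ∘′ ,-injectiveʳ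

  another-nearby : (x y : Vertex) → Near k n i (proj₁ x) → Near k n i (proj₁ y) →
                   Σ Vertex λ z → Nearby z × z ≢ x × z ≢ y
  another-nearby x y x-near y-near with avoid-two (proj₂ x) (proj₂ y)
  ... | d , d≢cx , d≢cy with S (i , d) in Sid
  ...   | true  = (i , d) , (Sid , inj₁ refl) , d≢cx ∘′ ,-injectiveʳ , d≢cy ∘′ ,-injectiveʳ
  ...   | false with proj₂ secure (i , d) Sid
  ...     | v , Sv , v~id , dom with vertexDec n m v x | vertexDec n m v y
  ...       | no v≢x   | no v≢y = v , (Sv , inj₂ (proj₁ v~id)) , v≢x , v≢y
  ...       | yes refl | _      = nearby-avoiding-defender y Sv v~id dom y-near d≢cy
  ...       | no _     | yes refl with nearby-avoiding-defender x Sv v~id dom x-near d≢cx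
  ...         | z , z-nearby , z≢y , z≢x = z , z-nearby , z≢x , z≢y

  some-nearby : Σ Vertex Nearby
  some-nearby with S (i , zero) in Si0
  ... | true  = (i , zero) , Si0 , inj₁ refl
  ... | false with proj₁ secure (i , zero) Si0
  ...   | v , Sv , (v~i , _) = v , Sv , inj₂ v~i

  three-≤-countTrue-window : 3 ≤ countTrue S (window k n m (toℕ i))
  three-≤-countTrue-window with some-nearby
  ... | x , Sx , x-near with another-nearby x x x-near x-near
  ...   | y , (Sy , y-near) , y≢x , _ with another-nearby x y x-near y-near
  ...     | z , (Sz , z-near) , z≢x , z≢y =
    length-≤-countTrue (vertexDec n m)
      ((y≢x ∘′ sym ∷ z≢x ∘′ sym ∷ []) ∷ (z≢y ∘′ sym ∷ []) ∷ [] ∷ [])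
      (∈-window (proj₂ x) x-near ∷ ∈-window (proj₂ y) y-near ∷
       ∈-window (proj₂ z) z-near ∷ [])
      (Sx ∷ Sy ∷ Sz ∷ [])

  three-≤-window-sum :
    3 ≤ sExt k n m S (toℕ i) + sExt k n m S (suc (toℕ i)) + sExt k n m S (suc (suc (toℕ i)))
  three-≤-window-sum = subst (3 ≤_) (countTrue-window k n m S (toℕ i)) three-≤-countTrue-window

lemma5p1 : (k : Kind) (n m : ℕ) → 3 ≤ m → 2 ≤ n →
    (S : Fin n × Fin m → Bool) →
    SecureDominating (vertexDec n m) (ProdAdj k n m) S →
    (i : ℕ) → 1 ≤ i → i ≤ n →
    3 ≤ sExt k n m S (i ∸ 1) + sExt k n m S i + sExt k n m S (i + 1)
lemma5p1 k (suc (suc n′)) (suc (suc (suc m′))) (s≤s (s≤s (s≤s _))) (s≤s (s≤s _))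
         S secure (suc t) _ t<n
  rewrite +-comm t 1 =
  subst (λ p → 3 ≤ sExt k _ _ S p + sExt k _ _ S (suc p) + sExt k _ _ S (suc (suc p)))
        (toℕ-fromℕ< t<n)
        (three-≤-window-sum k n′ m′ S secure (fromℕ< t<n))
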